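{- For every integer $k\ge 0$ and every $n\in\{8k+4,\,8k+6\}$, the edge-colored complete graph $K^\bullet_n$ contains no rainbow perfect matching.
   Context: For an integer $n\ge 1$, $K^\bullet_n$ denotes the complete graph on vertex set $V=\{0,1,\ldots,n-1\}$ whose edges are colored by the circular-distance edge coloring: the edge $\{i,j\}$ receives color $c_{\min\{|i-j|,\,n-|i-j|\}}$, where $c_1,c_2,\ldots$ are distinct colors. Thus exactly $\lfloor n/2\rfloor$ colors $c_1,\ldots,c_{\lfloor n/2\rfloor}$ are used. A rainbow matching is a matching (set of pairwise vertex-disjoint edges) whose edges have pairwise distinct colors. For $n$ even, a rainbow perfect matching in $K^\bullet_n$ is a rainbow matching covering all $n$ vertices (equivalently, a rainbow matching with $n/2$ edges). -}

module Defs where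

open import Data.Nat using (ℕ; _∸_; _⊓_; _+_; _*_)
open import Data.Nat.Properties using ()
open import Data.Fin using (Fin; toℕ)
open import Data.Product using (_×_; _,_; proj₁; proj₂)
open import Data.List using (List; []; _∷_; map; concatMap)
open import Data.List.Relation.Unary.All using (All)
open import Data.List.Relation.Unary.Unique.Propositional using (Unique)
open import Data.List.Membership.Propositional using (_∈_)
open import Relation.Binary.PropositionalEquality using (_≡_; _≢_)

absDiff : ℕ → ℕ → ℕ
absDiff a b = (a ∸ b) + (b ∸ a)

circDist : (n : ℕ) → Fin n → Fin n → ℕ
circDist n i j = absDiff (toℕ i) (toℕ j) ⊓ (n ∸ absDiff (toℕ i) (toℕ j))

Edge : ℕ → Set
Edge n = Fin n × Fin n

IsEdge : ∀ {n} → Edge n → Set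
IsEdge (i , j) = i ≢ j

-- color of an edge (color c_d represented by d)
color : ∀ {n} → Edge n → ℕ
color {n} (i , j) = circDist n i j

endpoints : ∀ {n} → List (Edge n) → List (Fin n)
endpoints = concatMap (λ e → proj₁ e ∷ proj₂ e ∷ [])

-- a matching: a list of edges whose endpoints are pairwise distinct
-- (so edges are pairwise vertex-disjoint, and no edge is listed twice)
IsMatching : ∀ {n} → List (Edge n) → Set
IsMatching M = All IsEdge M × Unique (endpoints M)

IsRainbow : ∀ {n} → List (Edge n) → Set
IsRainbow M = Unique (map color M)

IsPerfect : ∀ {n} → List (Edge n) → Set
IsPerfect {n} M = (v : Fin n) → v ∈ endpoints M

IsRainbowPerfectMatching : ∀ {n} → List (Edge n) → Set
IsRainbowPerfectMatching M = IsMatching M × IsRainbow M × IsPerfect M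

module Submission where

-- On a cycle of even length n, the colour d ⊓ (n ∸ d) of an edge {i, j}, where d = |i − j|,
-- has the parity of i + j. A rainbow perfect matching of K•_n with n = 2m covers every vertex
-- once and uses every colour 1, …, m once, so summing over its edges gives
-- 0 + 1 + ⋯ + (n − 1) ≡ 1 + 2 + ⋯ + m (mod 2). Triangular numbers are 4-periodic mod 2,
-- and for n = 8k + 4 and n = 8k + 6 the two sides have opposite parities.

open import Defs
open import Data.Nat using (ℕ; zero; suc; _+_; _*_; _∸_; _⊓_; _≤_; _<_; z≤n; s≤s; ∣_-_∣)
open import Data.Nat.Properties
open import Data.Nat.ListAction using (sum)
open import Data.Nat.ListAction.Properties using (sum-↭)
open import Data.Nat.Tactic.RingSolver using (solve-∀)
open import Data.Bool using (Bool; false; not; _xor_)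
open import Data.Bool.Properties using (not-distribˡ-xor; xor-assoc; xor-comm; xor-same; xor-identityʳ)
open import Data.Fin using (Fin; toℕ; fromℕ<)
open import Data.Fin.Properties using (toℕ-injective; toℕ<n; toℕ-fromℕ<)
open import Data.List using (List; []; _∷_; map; length; downFrom)
open import Data.List.Properties using (length-map; length-downFrom)
open import Data.List.Membership.Propositional using (_∈_)
open import Data.List.Membership.Propositional.Properties using (∈-map⁺; ∈-map⁻; ∈-downFrom⁺; ∈-downFrom⁻)
open import Data.List.Membership.Propositional.Properties.WithK using (unique∧set⇒bag)
open import Data.List.Relation.Binary.BagAndSetEquality using (∼bag⇒↭)
open import Data.List.Relation.Binary.Permutation.Propositional using (_↭_)
open import Data.List.Relation.Binary.Permutation.Propositional.Properties using (↭-length)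
open import Data.List.Relation.Binary.Subset.Propositional using (_⊆_)
open import Data.List.Relation.Unary.All as All using (All)
open import Data.List.Relation.Unary.Any using (here; there; any?)
open import Data.List.Relation.Unary.AllPairs using ([]; _∷_)
open import Data.List.Relation.Unary.Unique.Propositional using (Unique)
open import Data.List.Relation.Unary.Unique.Propositional.Properties using (map⁺; downFrom⁺)
open import Data.Product using (_×_; _,_; ∃)
open import Data.Sum using (_⊎_; inj₁; inj₂)
open import Function.Bundles using (mk⇔)
open import Relation.Binary.Definitions using (DecidableEquality)
open import Relation.Binary.PropositionalEquality using (_≡_; _≢_; refl; sym; trans; cong; cong₂; subst; module ≡-Reasoning)
open import Relation.Nullary using (¬_; yes; no; contradiction)

parity : ℕ → Bool
parity zero    = false
parity (suc n) = not (parity n)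

parity-+ : ∀ m n → parity (m + n) ≡ parity m xor parity n
parity-+ zero    n = refl
parity-+ (suc m) n = trans (cong not (parity-+ m n)) (not-distribˡ-xor (parity m) (parity n))

parity-double : ∀ m → parity (m + m) ≡ false
parity-double m = trans (parity-+ m m) (xor-same (parity m))

parity-∸ : ∀ {m n} → n ≤ m → parity (m ∸ n) ≡ parity m xor parity n
parity-∸ {m} {n} n≤m = begin
  parity (m ∸ n)                              ≡⟨ xor-identityʳ _ ⟨
  parity (m ∸ n) xor false                    ≡⟨ cong (parity (m ∸ n) xor_) (xor-same (parity n)) ⟨
  parity (m ∸ n) xor (parity n xor parity n)  ≡⟨ xor-assoc (parity (m ∸ n)) _ _ ⟨
  (parity (m ∸ n) xor parity n) xor parity n  ≡⟨ cong (_xor parity n) (parity-+ (m ∸ n) n) ⟨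
  parity (m ∸ n + n) xor parity n             ≡⟨ cong (λ t → parity t xor parity n) (m∸n+n≡m n≤m) ⟩
  parity m xor parity n                       ∎
  where open ≡-Reasoning

parity-∣-∣ : ∀ m n → parity ∣ m - n ∣ ≡ parity (m + n)
parity-∣-∣ m n with ∣m-n∣≡[m∸n]∨[n∸m] m n
... | inj₁ eq = begin
  parity ∣ m - n ∣       ≡⟨ cong parity eq ⟩
  parity (m ∸ n)         ≡⟨ parity-∸ {m} {n} (∣m-n∣≡m∸n⇒n≤m eq) ⟩
  parity m xor parity n  ≡⟨ parity-+ m n ⟨
  parity (m + n)         ∎
  where open ≡-Reasoning
... | inj₂ eq = begin
  parity ∣ m - n ∣       ≡⟨ cong parity eq ⟩
  parity (n ∸ m)         ≡⟨ parity-∸ {n} {m} (∣m-n∣≡m∸n⇒n≤m (trans (∣-∣-comm n m) eq)) ⟩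
  parity n xor parity m  ≡⟨ xor-comm (parity n) (parity m) ⟩
  parity m xor parity n  ≡⟨ parity-+ m n ⟨
  parity (m + n)         ∎
  where open ≡-Reasoning

triangle : ℕ → ℕ
triangle t = sum (downFrom t)

parity-triangle-4+ : ∀ t → parity (triangle (4 + t)) ≡ parity (triangle t)
parity-triangle-4+ t = begin
  parity (triangle (4 + t))               ≡⟨ cong parity (unfold t (triangle t)) ⟩
  parity (h + h + triangle t)             ≡⟨ parity-+ (h + h) (triangle t) ⟩
  parity (h + h) xor parity (triangle t)  ≡⟨ cong (_xor parity (triangle t)) (parity-double h) ⟩
  parity (triangle t)                     ∎
  where
  open ≡-Reasoning
  h = 2 * t + 3
  unfold : ∀ x s → 3 + x + (2 + x + (1 + x + (x + s))) ≡ (2 * x + 3) + (2 * x + 3) + s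
  unfold = solve-∀

parity-triangle : ∀ {t} q r → t ≡ q * 4 + r → parity (triangle t) ≡ parity (triangle r)
parity-triangle zero    r refl = refl
parity-triangle (suc q) r refl = trans (parity-triangle-4+ (q * 4 + r)) (parity-triangle q r refl)

sum-map-suc-downFrom : ∀ m → sum (map suc (downFrom m)) ≡ triangle (suc m)
sum-map-suc-downFrom zero    = refl
sum-map-suc-downFrom (suc m) = cong (suc m +_) (sum-map-suc-downFrom m)

⊓-∸-pos : ∀ {d n} → 0 < d → d < n → 0 < d ⊓ (n ∸ d)
⊓-∸-pos 0<d d<n = ⊓-glb 0<d (m<n⇒0<n∸m d<n)

⊓-∸-≤-half : ∀ {d n} m → n ≡ m + m → d ⊓ (n ∸ d) ≤ m
⊓-∸-≤-half {d} {n} m n≡m+m with ≤-total d m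
... | inj₁ d≤m = ≤-trans (m⊓n≤m d (n ∸ d)) d≤m
... | inj₂ m≤d = begin
  d ⊓ (n ∸ d)  ≤⟨ m⊓n≤n d (n ∸ d) ⟩
  n ∸ d        ≤⟨ ∸-monoʳ-≤ n m≤d ⟩
  n ∸ m        ≡⟨ cong (_∸ m) n≡m+m ⟩
  m + m ∸ m    ≡⟨ m+n∸n≡m m m ⟩
  m            ∎
  where open ≤-Reasoning

parity-⊓-∸ : ∀ {d n} → d ≤ n → parity n ≡ false → parity (d ⊓ (n ∸ d)) ≡ parity d
parity-⊓-∸ {d} {n} d≤n n-even with ⊓-sel d (n ∸ d)
... | inj₁ eq = cong parity eq
... | inj₂ eq = trans (cong parity eq) (trans (parity-∸ d≤n) (cong (_xor parity d) n-even))

module _ {n : ℕ} (i j : Fin n) where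

  private
    d = ∣ toℕ i - toℕ j ∣

    circDist≡ : circDist n i j ≡ d ⊓ (n ∸ d)
    circDist≡ = cong (λ d → d ⊓ (n ∸ d)) (absDiff≡∣-∣ (toℕ i) (toℕ j))
      where
      absDiff≡∣-∣ : ∀ a b → absDiff a b ≡ ∣ a - b ∣
      absDiff≡∣-∣ zero    zero    = refl
      absDiff≡∣-∣ zero    (suc b) = refl
      absDiff≡∣-∣ (suc a) zero    = +-identityʳ (suc a)
      absDiff≡∣-∣ (suc a) (suc b) = absDiff≡∣-∣ a b

    d<n : d < n
    d<n = ≤-<-trans (∣m-n∣≤m⊔n (toℕ i) (toℕ j)) (⊔-lub (toℕ<n i) (toℕ<n j))

  circDist-pos : i ≢ j → 0 < circDist n i j
  circDist-pos i≢j = subst (0 <_) (sym circDist≡)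
    (⊓-∸-pos (n≢0⇒n>0 (λ d≡0 → i≢j (toℕ-injective (∣m-n∣≡0⇒m≡n d≡0)))) d<n)

  circDist-≤-half : ∀ m → n ≡ m + m → circDist n i j ≤ m
  circDist-≤-half m n≡m+m = subst (_≤ m) (sym circDist≡) (⊓-∸-≤-half m n≡m+m)

  parity-circDist : parity n ≡ false → parity (circDist n i j) ≡ parity (toℕ i + toℕ j)
  parity-circDist n-even = begin
    parity (circDist n i j)  ≡⟨ cong parity circDist≡ ⟩
    parity (d ⊓ (n ∸ d))     ≡⟨ parity-⊓-∸ (<⇒≤ d<n) n-even ⟩
    parity d                 ≡⟨ parity-∣-∣ (toℕ i) (toℕ j) ⟩
    parity (toℕ i + toℕ j)   ∎
    where open ≡-Reasoning

module _ {a} {A : Set a} where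

  ∈⇒removal : ∀ {x : A} {ys} → x ∈ ys →
              ∃ λ ys′ → length ys ≡ suc (length ys′) × (∀ {z} → z ∈ ys → z ≢ x → z ∈ ys′)
  ∈⇒removal {ys = y ∷ ys} (here refl) =
    ys , refl , λ { (here refl) z≢x → contradiction refl z≢x ; (there z∈ys) _ → z∈ys }
  ∈⇒removal {ys = y ∷ ys} (there x∈ys) with ys′ , len , keep ← ∈⇒removal x∈ys =
    y ∷ ys′ , cong suc len , λ { (here refl) _ → here refl ; (there z∈ys) z≢x → there (keep z∈ys z≢x) }

  unique-⊆⇒length-≤ : ∀ {xs ys : List A} → Unique xs → xs ⊆ ys → length xs ≤ length ys
  unique-⊆⇒length-≤ [] _ = z≤n
  unique-⊆⇒length-≤ (x∉xs ∷ xs!) xs⊆ys with ys′ , len , keep ← ∈⇒removal (xs⊆ys (here refl)) =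
    subst (_ ≤_) (sym len)
      (s≤s (unique-⊆⇒length-≤ xs! λ z∈xs → keep (xs⊆ys (there z∈xs)) λ { refl → All.lookup x∉xs z∈xs refl }))

  unique-⊆∧length-≤⇒⊇ : DecidableEquality A → ∀ {xs ys : List A} → Unique xs → xs ⊆ ys →
                        length ys ≤ length xs → ys ⊆ xs
  unique-⊆∧length-≤⇒⊇ _≟_ {xs} xs! xs⊆ys ys≤xs {y} y∈ys with any? (y ≟_) xs
  ... | yes y∈xs = y∈xs
  ... | no  y∉xs with ys′ , len , keep ← ∈⇒removal y∈ys =
    contradiction (subst (_≤ length xs) len ys≤xs)
      (<⇒≱ (s≤s (unique-⊆⇒length-≤ xs! λ z∈xs → keep (xs⊆ys z∈xs) λ { refl → y∉xs z∈xs })))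

  unique-⊆-⊇⇒↭ : ∀ {xs ys : List A} → Unique xs → Unique ys → xs ⊆ ys → ys ⊆ xs → xs ↭ ys
  unique-⊆-⊇⇒↭ xs! ys! xs⊆ys ys⊆xs = ∼bag⇒↭ (unique∧set⇒bag xs! ys! (mk⇔ xs⊆ys ys⊆xs))

m+m≡n+n⇒m≡n : ∀ {m n} → m + m ≡ n + n → m ≡ n
m+m≡n+n⇒m≡n {m} {n} eq = *-cancelˡ-≡ m n 2 (trans (double m) (trans eq (sym (double n))))
  where
  double : ∀ k → 2 * k ≡ k + k
  double k = cong (k +_) (+-identityʳ k)

length-endpoints : ∀ {n} (M : List (Edge n)) → length (endpoints M) ≡ length M + length M
length-endpoints []      = refl
length-endpoints (e ∷ M) = cong suc (trans (cong suc (length-endpoints M)) (sym (+-suc (length M) (length M))))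

parity-sum-endpoints : ∀ {n} → parity n ≡ false → (M : List (Edge n)) →
                       parity (sum (map toℕ (endpoints M))) ≡ parity (sum (map color M))
parity-sum-endpoints n-even []            = refl
parity-sum-endpoints n-even ((i , j) ∷ M) = begin
  parity (toℕ i + (toℕ j + S))        ≡⟨ cong parity (+-assoc (toℕ i) (toℕ j) S) ⟨
  parity (toℕ i + toℕ j + S)          ≡⟨ parity-+ (toℕ i + toℕ j) S ⟩
  parity (toℕ i + toℕ j) xor parity S ≡⟨ cong₂ _xor_ (sym (parity-circDist i j n-even)) (parity-sum-endpoints n-even M) ⟩
  parity c xor parity C               ≡⟨ parity-+ c C ⟨
  parity (c + C)                      ∎
  where
  open ≡-Reasoning
  c = color (i , j)
  C = sum (map color M)
  S = sum (map toℕ (endpoints M))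

module _ {n : ℕ} {M : List (Edge n)} where

  endpoints-↭-downFrom : IsMatching M → IsPerfect M → map toℕ (endpoints M) ↭ downFrom n
  endpoints-↭-downFrom (_ , endpoints!) perfect =
    unique-⊆-⊇⇒↭ (map⁺ toℕ-injective endpoints!) (downFrom⁺ n) ⊆downFrom downFrom⊆
    where
    ⊆downFrom : map toℕ (endpoints M) ⊆ downFrom n
    ⊆downFrom v∈ with v , _ , refl ← ∈-map⁻ toℕ v∈ = ∈-downFrom⁺ (toℕ<n v)

    downFrom⊆ : downFrom n ⊆ map toℕ (endpoints M)
    downFrom⊆ v∈ = subst (_∈ _) (toℕ-fromℕ< (∈-downFrom⁻ v∈)) (∈-map⁺ toℕ (perfect (fromℕ< (∈-downFrom⁻ v∈))))

  colours-↭ : ∀ m → n ≡ m + m → All IsEdge M → IsRainbow M → length M ≡ m →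
              map color M ↭ map suc (downFrom m)
  colours-↭ m n≡m+m proper rainbow |M|≡m =
    unique-⊆-⊇⇒↭ rainbow oneToM! ⊆oneToM (unique-⊆∧length-≤⇒⊇ _≟_ rainbow ⊆oneToM lengths)
    where
    oneToM! : Unique (map suc (downFrom m))
    oneToM! = map⁺ suc-injective (downFrom⁺ m)

    ⊆oneToM : map color M ⊆ map suc (downFrom m)
    ⊆oneToM c∈ with (i , j) , e∈M , refl ← ∈-map⁻ color c∈ =
      inOneToM (circDist-pos i j (All.lookup proper e∈M)) (circDist-≤-half i j m n≡m+m)
      where
      inOneToM : ∀ {c} → 0 < c → c ≤ m → c ∈ map suc (downFrom m)
      inOneToM {suc c} _ c<m = ∈-map⁺ suc (∈-downFrom⁺ c<m)

    lengths : length (map suc (downFrom m)) ≤ length (map color M)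
    lengths = ≤-reflexive (begin
      length (map suc (downFrom m))  ≡⟨ length-map suc (downFrom m) ⟩
      length (downFrom m)            ≡⟨ length-downFrom m ⟩
      m                              ≡⟨ |M|≡m ⟨
      length M                       ≡⟨ length-map color M ⟨
      length (map color M)           ∎)
      where open ≡-Reasoning

  rainbowPerfect⇒parity : ∀ m → n ≡ m + m → IsRainbowPerfectMatching M →
                          parity (triangle n) ≡ parity (triangle (suc m))
  rainbowPerfect⇒parity m n≡m+m (matching@(proper , _) , rainbow , perfect) = begin
    parity (sum (downFrom n))                  ≡⟨ cong parity (sum-↭ vertices) ⟨
    parity (sum (map toℕ (endpoints M)))       ≡⟨ parity-sum-endpoints n-even M ⟩
    parity (sum (map color M))                 ≡⟨ cong parity (sum-↭ (colours-↭ m n≡m+m proper rainbow |M|≡m)) ⟩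
    parity (sum (map suc (downFrom m)))        ≡⟨ cong parity (sum-map-suc-downFrom m) ⟩
    parity (triangle (suc m))                  ∎
    where
    open ≡-Reasoning
    vertices : map toℕ (endpoints M) ↭ downFrom n
    vertices = endpoints-↭-downFrom matching perfect

    n-even : parity n ≡ false
    n-even = trans (cong parity n≡m+m) (parity-double m)

    |M|≡m : length M ≡ m
    |M|≡m = m+m≡n+n⇒m≡n (begin
      length M + length M              ≡⟨ length-endpoints M ⟨
      length (endpoints M)             ≡⟨ length-map toℕ (endpoints M) ⟨
      length (map toℕ (endpoints M))   ≡⟨ ↭-length vertices ⟩
      length (downFrom n)              ≡⟨ length-downFrom n ⟩
      n                                ≡⟨ n≡m+m ⟩
      m + m                            ∎)

theorem1 : (k n : ℕ) → (n ≡ 8 * k + 4 ⊎ n ≡ 8 * k + 6) →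
    (M : List (Edge n)) → ¬ IsRainbowPerfectMatching M
theorem1 k n (inj₁ refl) M rpm = contradiction (begin
  parity (triangle 0)                  ≡⟨ parity-triangle (2 * k + 1) 0 (8k+4≡[2k+1]*4+0 k) ⟨
  parity (triangle (8 * k + 4))        ≡⟨ rainbowPerfect⇒parity (4 * k + 2) (8k+4≡[4k+2]*2 k) rpm ⟩
  parity (triangle (suc (4 * k + 2)))  ≡⟨ parity-triangle k 3 (4k+3≡k*4+3 k) ⟩
  parity (triangle 3)                  ∎) λ ()
  where
  open ≡-Reasoning
  8k+4≡[2k+1]*4+0 : ∀ k → 8 * k + 4 ≡ (2 * k + 1) * 4 + 0
  8k+4≡[2k+1]*4+0 = solve-∀
  8k+4≡[4k+2]*2 : ∀ k → 8 * k + 4 ≡ (4 * k + 2) + (4 * k + 2)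
  8k+4≡[4k+2]*2 = solve-∀
  4k+3≡k*4+3 : ∀ k → suc (4 * k + 2) ≡ k * 4 + 3
  4k+3≡k*4+3 = solve-∀
theorem1 k n (inj₂ refl) M rpm = contradiction (begin
  parity (triangle 2)                  ≡⟨ parity-triangle (2 * k + 1) 2 (8k+6≡[2k+1]*4+2 k) ⟨
  parity (triangle (8 * k + 6))        ≡⟨ rainbowPerfect⇒parity (4 * k + 3) (8k+6≡[4k+3]*2 k) rpm ⟩
  parity (triangle (suc (4 * k + 3)))  ≡⟨ parity-triangle (suc k) 0 (4k+4≡[k+1]*4+0 k) ⟩
  parity (triangle 0)                  ∎) λ ()
  where
  open ≡-Reasoning
  8k+6≡[2k+1]*4+2 : ∀ k → 8 * k + 6 ≡ (2 * k + 1) * 4 + 2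
  8k+6≡[2k+1]*4+2 = solve-∀
  8k+6≡[4k+3]*2 : ∀ k → 8 * k + 6 ≡ (4 * k + 3) + (4 * k + 3)
  8k+6≡[4k+3]*2 = solve-∀
  4k+4≡[k+1]*4+0 : ∀ k → suc (4 * k + 3) ≡ suc k * 4 + 0
  4k+4≡[k+1]*4+0 = solve-∀
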